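{- For every positive integer $n$ and every $\mathcal{I}\subseteq\{0,\ldots,n-1\}$, the maniplex $\mathcal{M}_n$ admits a bi-colouring of its flags consistent with $\mathcal{I}$.
   Context: An $n$-maniplex is a pair $(\mathcal{F},\{r_0,\ldots,r_{n-1}\})$ where $\mathcal{F}$ is a non-empty set of flags and $r_0,\ldots,r_{n-1}$ are fixed-point-free involutory permutations of $\mathcal{F}$ such that $\langle r_0,\ldots,r_{n-1}\rangle$ is transitive on $\mathcal{F}$, $\Phi^{r_i}\neq\Phi^{r_j}$ for all $\Phi$ and $i\ne j$, and $r_ir_j=r_jr_i$ whenever $|i-j|\ge2$; $\Phi$ and $\Phi^{r_i}$ are $i$-adjacent. The facets are the orbits of $\langle r_0,\ldots,r_{n-2}\rangle$. For an $n$-maniplex $\mathcal{M}$ with set of facets $\mathcal{S}$, let $F(\Phi)$ be the facet containing $\Phi$ and $\chi_F\in\mathbb{Z}_2^{\mathcal{S}}$ the characteristic function of $F$; the $(n+1)$-maniplex $\hat{2}^{\mathcal{M}}$ has flag set $\mathcal{F}(\mathcal{M})\times\mathbb{Z}_2^{\mathcal{S}}$ and permutations $(\Phi,x)^{r'_i}=(\Phi^{r_i},x)$ for $i<n$ and $(\Phi,x)^{r'_n}=(\Phi,x+\chi_{F(\Phi)})$. Define $\mathcal{M}_1$ to be the unique regular polytope of rank $1$ (as a maniplex: two flags interchanged by $r_0$), and for $n\ge2$ let $\mathcal{M}_n=\hat{2}^{\mathcal{M}_{n-1}}$ (e.g. $\mathcal{M}_2$ is the square and $\mathcal{M}_3$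 is the toroidal map $\{4,4\}_{(4,0)}$). A bi-colouring consistent with $\mathcal{I}$ is a colouring of the flags black and white such that $i$-adjacent flags have the same colour if and only if $i\in\mathcal{I}$. -}

module Defs where

open import Data.Nat using (ℕ; zero; suc; _^_)
open import Data.Fin using (Fin; zero; suc; combine)
open import Data.Bool using (Bool; true; false; not)
open import Data.Vec using (Vec; []; _∷_; updateAt)
open import Data.Product using (_×_; _,_)
open import Function using (_∘_)

-- Case split on Fin (suc n): the indices inject₁ j (handled by f j) and
-- the last index n (handled by a).
lastCase : ∀ {n} {A : Set} → (Fin n → A) → A → Fin (suc n) → A
lastCase {zero}  f a zero    = a
lastCase {suc m} f a zero    = f zero
lastCase {suc m} f a (suc i) = lastCase (f ∘ suc) a i

-- An n-maniplex presented by its flags, its involutions r_0,…,r_{n-1},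
-- and its facets: nf facets, indexed by Fin nf, with facet Φ the facet
-- (orbit of ⟨r_0,…,r_{n-2}⟩) containing Φ.
record Maniplex (n : ℕ) : Set₁ where
  field
    Flag  : Set
    r     : Fin n → Flag → Flag
    nf    : ℕ
    facet : Flag → Fin nf

-- A bijection Z_2^k ≅ Fin (2^k), used to index the facets of 2^M.
encode : ∀ {k} → Vec Bool k → Fin (2 ^ k)
encode []              = zero
encode {suc k} (false ∷ v) = combine {2} {2 ^ k} zero (encode v)
encode {suc k} (true  ∷ v) = combine {2} {2 ^ k} (suc zero) (encode v)

-- Flags: F(M) × Z_2^S (S = facets of M, Z_2 = Bool,
-- x + χ_F = flip coordinate F).  The facets of 2^M (orbits of
-- ⟨r'_0,…,r'_{n-1}⟩) are exactly the sets F(M) × {x}, x ∈ Z_2^S,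
-- since ⟨r_0..r_{n-1}⟩ is transitive on F(M) and r'_i (i<n) fix x.
twoHat : ∀ {n} → Maniplex n → Maniplex (suc n)
twoHat {n} M = record
  { Flag  = Flag × Vec Bool nf
  ; r     = lastCase (λ i → λ { (Φ , x) → (r i Φ , x) })
                     (λ { (Φ , x) → (Φ , updateAt x (facet Φ) not) })
  ; nf    = 2 ^ nf
  ; facet = λ { (Φ , x) → encode x }
  }
  where open Maniplex M

-- M_1: two flags swapped by r_0; the rank-0 "facets" (orbits of the
-- trivial group) are the single flags.
M₁ : Maniplex 1
M₁ = record
  { Flag  = Bool
  ; r     = λ _ → not
  ; nf    = 2
  ; facet = λ { false → zero ; true → suc zero }
  }

-- 𝓜 k = M_{k+1}
𝓜 : (k : ℕ) → Maniplex (suc k)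
𝓜 zero    = M₁
𝓜 (suc k) = twoHat (𝓜 k)

-- Given a colouring c of M consistent with I ∩ {0,…,n-1},
-- colour the flag (Φ, x) of 2^M by c(Φ), plus the parity of x when n ∉ I.
-- For i < n, r'_i changes Φ alone, so c decides; r'_n keeps Φ and flips one
-- coordinate of x, hence the parity, so the colour changes exactly when n ∉ I.
module Submission where

open import Defs
open import Data.Nat using (ℕ; suc; zero)
open import Data.Fin using (Fin; zero; suc; inject₁; fromℕ)
open import Data.Fin.Subset using (Subset; _∈_)
open import Data.Bool using (Bool; true; false; not; _xor_; _∧_)
open import Data.Bool.Properties
  using (not-¬; not-distribˡ-xor; not-distribʳ-xor; xor-∧-commutativeRing)
open import Data.Vec using (Vec; _∷_; updateAt; lookup; foldr)
open import Data.Vec.Properties using ([]=↔lookup)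
open import Data.Product using (Σ; _,_)
open import Algebra.Bundles using (CommutativeRing)
open import Algebra.Properties.Group (CommutativeRing.+-group xor-∧-commutativeRing)
  using (∙-cancelˡ; ∙-cancelʳ)
open import Function using (_∘_; const)
open import Function.Bundles using (_⇔_; mk⇔)
open import Function.Construct.Composition using (_⇔-∘_)
open import Function.Properties.Equivalence using () renaming (sym to ⇔-sym)
open import Function.Properties.Inverse using (↔⇒⇔)
open import Relation.Nullary using (contradiction)
open import Relation.Binary.PropositionalEquality using (_≡_; refl; sym; trans; cong)
open Maniplex using (Flag; r; facet)

lastCase-elim : ∀ {n} {A : Set} (P : Fin (suc n) → A → Set) (f : Fin n → A) (a : A) →
  (∀ j → P (inject₁ j) (f j)) → P (fromℕ n) a → ∀ i → P i (lastCase f a i)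
lastCase-elim {zero}  P f a Pf Pa zero    = Pa
lastCase-elim {suc m} P f a Pf Pa zero    = Pf zero
lastCase-elim {suc m} P f a Pf Pa (suc i) =
  lastCase-elim (P ∘ suc) (f ∘ suc) a (Pf ∘ suc) Pa i

parity : ∀ {m} → Vec Bool m → Bool
parity = foldr _ _xor_ false

parity-updateAt-not : ∀ {m} (x : Vec Bool m) i → parity (updateAt x i not) ≡ not (parity x)
parity-updateAt-not (a ∷ x) zero    = sym (not-distribˡ-xor a (parity x))
parity-updateAt-not (a ∷ x) (suc i) =
  trans (cong (a xor_) (parity-updateAt-not x i)) (sym (not-distribʳ-xor a (parity x)))

xor-cancelˡ-⇔ : ∀ a b c → (a xor b ≡ a xor c) ⇔ (b ≡ c)
xor-cancelˡ-⇔ a b c = mk⇔ (∙-cancelˡ a b c) (cong (a xor_))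

xor-cancelʳ-⇔ : ∀ a b c → (b xor a ≡ c xor a) ⇔ (b ≡ c)
xor-cancelʳ-⇔ a b c = mk⇔ (∙-cancelʳ a b c) (cong (_xor a))

not∧-not-fixed-⇔ : ∀ β p → (not β ∧ not p ≡ not β ∧ p) ⇔ (β ≡ true)
not∧-not-fixed-⇔ true  p = mk⇔ (const refl) (const refl)
not∧-not-fixed-⇔ false p = mk⇔ (λ e → contradiction (sym e) (not-¬ refl)) λ ()

Consistent : ∀ {n} (M : Maniplex n) → (Flag M → Bool) → (Fin n → Bool) → Set
Consistent M c I = ∀ i Φ → (c (r M i Φ) ≡ c Φ) ⇔ (I i ≡ true)

BiColouring : ∀ {n} → Maniplex n → (Fin n → Bool) → Set
BiColouring M I = Σ (Flag M → Bool) λ c → Consistent M c I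

M₁-biColouring : ∀ I → BiColouring M₁ I
M₁-biColouring I = not (I zero) ∧_ , λ { zero → not∧-not-fixed-⇔ (I zero) }

twoHat-biColouring : ∀ {n} (M : Maniplex n) (I : Fin (suc n) → Bool) →
  BiColouring M (I ∘ inject₁) → BiColouring (twoHat M) I
twoHat-biColouring {n} M I (c , c-consistent) =
  c′ , lastCase-elim P _ _ (λ j (Φ , x) → lower j Φ x) (λ (Φ , x) → top Φ x)
  where
  β : Bool
  β = I (fromℕ n)

  c′ : Flag (twoHat M) → Bool
  c′ (Φ , x) = c Φ xor (not β ∧ parity x)

  P : Fin (suc n) → (Flag (twoHat M) → Flag (twoHat M)) → Set
  P i g = ∀ Ψ → (c′ (g Ψ) ≡ c′ Ψ) ⇔ (I i ≡ true)

  lower : ∀ j Φ x → (c′ (r M j Φ , x) ≡ c′ (Φ , x)) ⇔ (I (inject₁ j) ≡ true)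
  lower j Φ x = c-consistent j Φ ⇔-∘ xor-cancelʳ-⇔ (not β ∧ parity x) _ _

  top : ∀ Φ x → (c′ (Φ , updateAt x (facet M Φ) not) ≡ c′ (Φ , x)) ⇔ (β ≡ true)
  top Φ x rewrite parity-updateAt-not x (facet M Φ) =
    not∧-not-fixed-⇔ β (parity x) ⇔-∘ xor-cancelˡ-⇔ (c Φ) _ _

𝓜-biColouring : ∀ k I → BiColouring (𝓜 k) I
𝓜-biColouring zero    I = M₁-biColouring I
𝓜-biColouring (suc k) I = twoHat-biColouring (𝓜 k) I (𝓜-biColouring k (I ∘ inject₁))

proposition11 : (k : ℕ) → (I : Subset (suc k)) →
    Σ (Flag (𝓜 k) → Bool) λ c →
    (i : Fin (suc k)) → (Φ : Flag (𝓜 k)) →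
    (c (r (𝓜 k) i Φ) ≡ c Φ) ⇔ (i ∈ I)
proposition11 k I with 𝓜-biColouring k (lookup I)
... | c , c-consistent = c , λ i Φ → ⇔-sym (↔⇒⇔ []=↔lookup) ⇔-∘ c-consistent i Φ
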